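{- Let $\Sigma$ be an alphabet, let $X$ be a weighted sequence of length $n$ over $\Sigma$, and let $z>0$ be a real threshold parameter. Then $X$ has a $z$-estimation, i.e. there exists an indexed family $\mathcal{S}=(S_j,\pi_j)_{j=1}^{\lfloor z\rfloor}$ of strings $S_j$ of length $n$ over $\Sigma$ with properties $\pi_j$ such that for every string $P$ and every position $i\in\{1,\ldots,n\}$ we have $\mathit{Count}_{\mathcal{S}}(P,i)=\lfloor \mathcal{P}_X(P,i)\, z\rfloor$.
   Context: A weighted sequence $X=x_1\cdots x_n$ of length $n$ over an alphabet $\Sigma$ assigns to every position $i\in\{1,\ldots,n\}$ and letter $c\in\Sigma$ a probability $p_i(c)\ge 0$, with $\sum_{c\in\Sigma}p_i(c)=1$ for each $i$. For a string $P$ and position $i$, the probability of matching is $\mathcal{P}_X(P,i)=\prod_{j=1}^{|P|}p_{i+j-1}(P[j])$, where $p_k(\cdot)=0$ for $k>n$ (so $\mathcal{P}_X(P,i)=0$ if $P$ does not fit in $X$ starting at $i$; $\mathcal{P}_X(\varepsilon,i)=1$). For a string $S$ of length $n$, a property is represented by an array $\pi[1..n]$ with $\pi[i]\in\{i-1,\ldots,n\}$ and $\pi[1]\le\pi[2]\le\cdots\le\pi[n]$ (it encodes the hereditary family of intervals contained in some $\{i,\ldots,\pi[i]\}$). For a string $P$, $\mathit{Occ}_\pi(P,S)$ is the set of positions $i$ such that $P=S[i..i+|P|-1]$ and $i+|P|-1\le\pi[i]$. For an indexed family $\mathcal{S}=(S_j,\pi_j)_{j=1}^k$, $\mathit{Count}_{\mathcal{S}}(P,i)=|\{j: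 i\in\mathit{Occ}_{\pi_j}(P,S_j)\}|$. -}

module Defs where

open import Level using (0ℓ)
open import Data.Bool using (Bool; true; false; if_then_else_; _∧_)
open import Data.Nat as ℕ using (ℕ; zero; suc)
import Data.Nat.Properties as ℕP
open import Data.Integer as ℤ using (ℤ; +_; -[1+_])
open import Data.Fin using (Fin; toℕ; fromℕ<)
import Data.Fin.Properties as FinP
open import Data.List using (List; []; _∷_; length)
open import Data.Product using (Σ; _×_; _,_)
open import Relation.Nullary using (¬_; yes; no)
open import Relation.Nullary.Decidable using (⌊_⌋)
open import Relation.Binary.PropositionalEquality using (_≡_; _≢_)
open import Algebra.Structures using (IsCommutativeRing)
open import Relation.Binary.Structures using (IsTotalOrder)

-- Agda's standard library has no real numbers, so
-- the probabilities and the threshold z live in an arbitrary totally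
-- ordered commutative ring equipped with a floor function (ℝ is an
-- instance; so is ℚ).

embedℕ : {A : Set} → (A → A → A) → A → A → ℕ → A
embedℕ _+_ 0# 1# zero    = 0#
embedℕ _+_ 0# 1# (suc m) = 1# + embedℕ _+_ 0# 1# m

embedℤ : {A : Set} → (A → A → A) → (A → A) → A → A → ℤ → A
embedℤ _+_ -_ 0# 1# (+ m)    = embedℕ _+_ 0# 1# m
embedℤ _+_ -_ 0# 1# -[1+ m ] = - embedℕ _+_ 0# 1# (suc m)

strictOf : {A : Set} → (A → A → Set) → A → A → Set
strictOf _≤_ x y = (x ≤ y) × (x ≢ y)

record OrderedRingWithFloor : Set₁ where
  infixl 6 _+_
  infixl 7 _*_
  infix 4 _≤_
  field
    Carrier : Set
    _+_ _*_ : Carrier → Carrier → Carrier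
    -_      : Carrier → Carrier
    0# 1#   : Carrier
    isCommutativeRing : IsCommutativeRing _≡_ _+_ _*_ -_ 0# 1#
    _≤_     : Carrier → Carrier → Set
    isTotalOrder : IsTotalOrder _≡_ _≤_
    +-mono-≤  : ∀ {x y} z → x ≤ y → x + z ≤ y + z
    *-nonneg  : ∀ {x y} → 0# ≤ x → 0# ≤ y → 0# ≤ x * y

    floor       : Carrier → ℤ
    floor-≤     : ∀ x → embedℤ _+_ -_ 0# 1# (floor x) ≤ x
    <-floor+1   : ∀ x → strictOf _≤_ x (embedℤ _+_ -_ 0# 1# (floor x ℤ.+ ℤ.+ 1))

  _<_ : Carrier → Carrier → Set
  _<_ = strictOf _≤_

  fromℤ : ℤ → Carrier
  fromℤ = embedℤ _+_ -_ 0# 1#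

module _ (R : OrderedRingWithFloor) where
  open OrderedRingWithFloor R

  sumFin : (σ : ℕ) → (Fin σ → Carrier) → Carrier
  sumFin zero    f = 0#
  sumFin (suc σ) f = f Fin.zero + sumFin σ (λ c → f (Fin.suc c))
    where import Data.Fin as Fin

  -- A weighted sequence of length n over the alphabet Fin σ.
  -- Positions are 0-based: position i ∈ Fin n is position i+1 of the paper.
  record WeightedSequence (σ n : ℕ) : Set where
    field
      p        : Fin n → Fin σ → Carrier
      p-nonneg : ∀ i c → 0# ≤ p i c
      p-sum    : ∀ i → sumFin σ (p i) ≡ 1#

  pAt : ∀ {σ n} → WeightedSequence σ n → ℕ → Fin σ → Carrier
  pAt {n = n} X k c with k ℕ.<? n
  ... | yes k<n = WeightedSequence.p X (fromℕ< k<n) c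
  ... | no  _   = 0#

  matchProb : ∀ {σ n} → WeightedSequence σ n → List (Fin σ) → ℕ → Carrier
  matchProb X []      k = 1#
  matchProb X (c ∷ P) k = pAt X k c * matchProb X P (suc k)

String : ℕ → ℕ → Set
String σ n = Fin n → Fin σ

-- With 0-based positions, end i
-- corresponds to the paper's π[i+1]; the paper's constraints
-- π[i] ∈ {i-1,…,n} and monotonicity become  toℕ i ≤ end i ≤ n
-- and monotonicity.  The interval allowed at 0-based i is [i, end i).
record Property (n : ℕ) : Set where
  field
    end      : Fin n → ℕ
    end-low  : ∀ i → toℕ i ℕ.≤ end i
    end-high : ∀ i → end i ℕ.≤ n
    end-mono : ∀ i j → toℕ i ℕ.≤ toℕ j → end i ℕ.≤ end j

matchesAt : ∀ {σ n} → String σ n → List (Fin σ) → ℕ → Bool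
matchesAt S []      k = true
matchesAt {n = n} S (c ∷ P) k with k ℕ.<? n
... | yes k<n = ⌊ S (fromℕ< k<n) FinP.≟ c ⌋ ∧ matchesAt S P (suc k)
... | no  _   = false

-- i ∈ Occ_π(P, S): P occurs at i and i + |P| - 1 ≤ π[i] (1-based),
-- i.e. toℕ i + |P| ≤ end i (0-based, exclusive end)
inOcc : ∀ {σ n} → Property n → String σ n → List (Fin σ) → Fin n → Bool
inOcc π S P i = matchesAt S P (toℕ i) ∧ ⌊ toℕ i ℕ.+ length P ℕ.≤? Property.end π i ⌋

count : ∀ {σ n k} → (Fin k → String σ n) → (Fin k → Property n) →
        List (Fin σ) → Fin n → ℕ
count {k = zero}  S π P i = 0
count {k = suc k} S π P i =
  (if inOcc (π Fin.zero) (S Fin.zero) P i then 1 else 0)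
    ℕ.+ count {k = k} (λ j → S (Fin.suc j)) (λ j → π (Fin.suc j)) P i
  where import Data.Fin as Fin

-- Let f(P, i) = ⌊𝒫_X(P, i) z⌋.  Since Σ_c 𝒫_X(Pc, i) ≤ 𝒫_X(P, i) and
-- Σ_c 𝒫_X(cP, i) ≤ 𝒫_X(P, i+1), and floors are superadditive, f is
-- subadditive under extending P to the right and to the left, and
-- f(ε, i) = ⌊z⌋.  Any such f is realised by ⌊z⌋ windows per position i:
-- words W_1(i), …, W_⌊z⌋(i) of which exactly f(P, i) have P as a prefix.
-- The windows at i+1 start as the windows at i without their first letter,
-- which overcount nothing by left subadditivity, and are greedily extended
-- to the right while some extension is undercounted; a family that
-- overcounts nothing and admits no such extension is exact by right
-- subadditivity.  The j-th string spells the first letters of the W_j(i),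
-- and its property admits at position i exactly the prefixes of W_j(i).

module Submission where

module WindowFamilies where

  open import Data.Bool using (Bool; true; false; T; _∧_; if_then_else_)
  open import Data.Bool.Properties using (∧-zeroʳ; ∧-identityʳ; T-≡)
  open import Data.Nat
    using (ℕ; zero; suc; _+_; _≤_; _<_; _<?_; _≤?_; z≤n; s≤s; z<s; _≤′_; ≤′-reflexive; ≤′-step)
  open import Data.Nat.Properties hiding (_≟_)
  open import Data.Fin using (Fin; zero; suc; toℕ; fromℕ<)
  open import Data.Fin.Properties using (_≟_; any?; toℕ<n; toℕ-fromℕ<)
  open import Data.List using (List; []; _∷_; length; _∷ʳ_; _++_; drop; head)
  open import Data.List.Properties using (≡-dec; ++-assoc; ++-identityʳ; length-++)
  open import Data.Maybe using (fromMaybe)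
  open import Data.Vec.Functional using (Vector; tail)
  open import Data.Product using (Σ; _,_; ∃)
  open import Data.Empty using (⊥-elim)
  open import Function using (_∘_; Equivalence)
  open import Relation.Nullary using (¬_; Dec; yes; no; does; contradiction)
  open import Relation.Nullary.Decidable using (⌊_⌋; isYes≗does; dec-true)
  open import Relation.Binary.PropositionalEquality
  open import Algebra.Properties.CommutativeMonoid.Sum +-0-commutativeMonoid
    using (sum; ∑-distrib-+; ∑-comm; sum-cong-≗; sum-replicate-zero; sum-remove)
  open import Algebra.Properties.CommutativeSemigroup +-commutativeSemigroup
    using (xy∙z≈xz∙y; x∙yz≈xz∙y)

  open import Defs using (String; Property; matchesAt; inOcc; count)

  private
    variable
      σ m : ℕ

  indicator : Bool → ℕ
  indicator b = if b then 1 else 0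

  sum-mono-≤ : ∀ {g h : Vector ℕ m} → (∀ j → g j ≤ h j) → sum g ≤ sum h
  sum-mono-≤ {zero}  g≤h = z≤n
  sum-mono-≤ {suc m} g≤h = +-mono-≤ (g≤h zero) (sum-mono-≤ (g≤h ∘ suc))

  sum-≤-tight : ∀ {g h : Vector ℕ m} → (∀ j → g j ≤ h j) → sum h ≤ sum g → ∀ j → g j ≡ h j
  sum-≤-tight {suc m} {g} {h} g≤h h≤g zero = ≤-antisym (g≤h zero)
    (+-cancelʳ-≤ (sum (g ∘ suc)) (h zero) (g zero)
      (≤-trans (+-monoʳ-≤ (h zero) (sum-mono-≤ (g≤h ∘ suc))) h≤g))
  sum-≤-tight {suc m} {g} {h} g≤h h≤g (suc j) = sum-≤-tight (g≤h ∘ suc)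
    (+-cancelˡ-≤ (g zero) _ _ (≤-trans (+-monoˡ-≤ _ (g≤h zero)) h≤g)) j

  term-≤-sum : ∀ (g : Vector ℕ (suc m)) j → g j ≤ sum g
  term-≤-sum g j = ≤-trans (m≤m+n (g j) _) (≤-reflexive (sym (sum-remove {i = j} g)))

  Word : ℕ → Set
  Word σ = List (Fin σ)

  infix 4 _≼ᵇ_ _≟ᴸ_

  _≟ᴸ_ : (P Q : Word σ) → Dec (P ≡ Q)
  _≟ᴸ_ = ≡-dec _≟_

  _≼ᵇ_ : Word σ → Word σ → Bool
  []      ≼ᵇ w       = true
  (a ∷ P) ≼ᵇ []      = false
  (a ∷ P) ≼ᵇ (b ∷ w) = does (b ≟ a) ∧ (P ≼ᵇ w)

  ≼ᵇ-refl : ∀ (w : Word σ) → T (w ≼ᵇ w)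
  ≼ᵇ-refl []      = _
  ≼ᵇ-refl (a ∷ w) with a ≟ a
  ... | yes _  = ≼ᵇ-refl w
  ... | no a≢a = a≢a refl

  ≼ᵇ-trans : ∀ (P w u : Word σ) → T (P ≼ᵇ w) → T (w ≼ᵇ u) → T (P ≼ᵇ u)
  ≼ᵇ-trans []      w       u       _    _    = _
  ≼ᵇ-trans (a ∷ P) (b ∷ w) (c ∷ u) P≼w w≼u with b ≟ a | c ≟ b
  ... | yes refl | yes refl rewrite dec-true (c ≟ c) refl = ≼ᵇ-trans P w u P≼w w≼u

  ≼ᵇ-length : ∀ (P w : Word σ) → T (P ≼ᵇ w) → length P ≤ length w
  ≼ᵇ-length []      w       _   = z≤n
  ≼ᵇ-length (a ∷ P) (b ∷ w) P≼w with b ≟ a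
  ... | yes _ = s≤s (≼ᵇ-length P w P≼w)

  ≼ᵇ-∷ʳ : ∀ (w : Word σ) c → T (w ≼ᵇ w ∷ʳ c)
  ≼ᵇ-∷ʳ []      c = _
  ≼ᵇ-∷ʳ (b ∷ w) c rewrite dec-true (b ≟ b) refl = ≼ᵇ-∷ʳ w c

  ≼ᵇ-∷ʳ-≢ : ∀ (P w : Word σ) c → P ≢ w ∷ʳ c → (P ≼ᵇ w ∷ʳ c) ≡ (P ≼ᵇ w)
  ≼ᵇ-∷ʳ-≢ []          w       c _   = refl
  ≼ᵇ-∷ʳ-≢ (a ∷ [])    []      c P≢c with c ≟ a
  ... | yes refl = contradiction refl P≢c
  ... | no  _    = refl
  ≼ᵇ-∷ʳ-≢ (a ∷ _ ∷ _) []      c _   = ∧-zeroʳ _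
  ≼ᵇ-∷ʳ-≢ (a ∷ P)     (b ∷ w) c P≢w with b ≟ a
  ... | yes refl = ≼ᵇ-∷ʳ-≢ P w c (P≢w ∘ cong (b ∷_))
  ... | no  _    = refl

  ≼ᵇ-extend : ∀ (P u v : Word σ) → T (u ≼ᵇ v) → length P ≤ length u → (P ≼ᵇ u) ≡ (P ≼ᵇ v)
  ≼ᵇ-extend []      u       v       _   _         = refl
  ≼ᵇ-extend (a ∷ P) (b ∷ u) (c ∷ v) u≼v (s≤s P≤u) with c ≟ b
  ... | yes refl = cong (does (c ≟ a) ∧_) (≼ᵇ-extend P u v u≼v P≤u)

  T-false : ∀ {b} → ¬ T b → b ≡ false
  T-false {false} _  = refl
  T-false {true}  ¬T = contradiction _ ¬T

  indicator-mono : ∀ {b c} → (T b → T c) → indicator b ≤ indicator c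
  indicator-mono {false}         _   = z≤n
  indicator-mono {true}  {true}  _   = ≤-refl
  indicator-mono {true}  {false} b⇒c = ⊥-elim (b⇒c _)

  sum-indicator-≟ : ∀ (b : Fin σ) x → sum (λ c → indicator (does (b ≟ c) ∧ x)) ≡ indicator x
  sum-indicator-≟ {suc σ} zero x = trans (cong (indicator x +_) (sum-replicate-zero σ)) (+-identityʳ _)
  sum-indicator-≟         (suc b) x = sum-indicator-≟ b x

  indicator-≼ᵇ-split : ∀ (Q w : Word σ) →
    indicator (Q ≼ᵇ w) ≡ indicator (does (w ≟ᴸ Q)) + sum (λ c → indicator (Q ∷ʳ c ≼ᵇ w))
  indicator-≼ᵇ-split {σ} []      []      = cong suc (sym (sum-replicate-zero σ))
  indicator-≼ᵇ-split     []      (b ∷ w) = sym (sum-indicator-≟ b true)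
  indicator-≼ᵇ-split {σ} (a ∷ Q) []      = sym (sum-replicate-zero σ)
  indicator-≼ᵇ-split {σ} (a ∷ Q) (b ∷ w) with b ≟ a
  ... | yes _ = indicator-≼ᵇ-split Q w
  ... | no  _ = sym (sum-replicate-zero σ)

  indicator-drop-≼ᵇ : ∀ a (P w : Word σ) →
    indicator (a ∷ P ≼ᵇ drop 1 w) ≡ sum (λ c → indicator (c ∷ a ∷ P ≼ᵇ w))
  indicator-drop-≼ᵇ {σ} a P []      = sym (sum-replicate-zero σ)
  indicator-drop-≼ᵇ     a P (b ∷ w) = sym (sum-indicator-≟ b _)

  prefixCount : Vector (Word σ) m → Word σ → ℕ
  prefixCount V P = sum (λ j → indicator (P ≼ᵇ V j))

  exactCount : Vector (Word σ) m → Word σ → ℕ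
  exactCount V Q = sum (λ j → indicator (does (V j ≟ᴸ Q)))

  prefixCount-[] : ∀ (V : Vector (Word σ) m) → prefixCount V [] ≡ m
  prefixCount-[] {m = zero}  V = refl
  prefixCount-[] {m = suc m} V = cong suc (prefixCount-[] (tail V))

  prefixCount-split : ∀ (V : Vector (Word σ) m) Q →
    prefixCount V Q ≡ exactCount V Q + sum (λ c → prefixCount V (Q ∷ʳ c))
  prefixCount-split {σ} {m} V Q = begin
    prefixCount V Q
      ≡⟨ sum-cong-≗ (λ j → indicator-≼ᵇ-split Q (V j)) ⟩
    sum (λ j → indicator (does (V j ≟ᴸ Q)) + sum (λ c → indicator (Q ∷ʳ c ≼ᵇ V j)))
      ≡⟨ ∑-distrib-+ {m} _ _ ⟩
    exactCount V Q + sum (λ j → sum (λ c → indicator (Q ∷ʳ c ≼ᵇ V j)))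
      ≡⟨ cong (exactCount V Q +_) (∑-comm {m} {σ} _) ⟩
    exactCount V Q + sum (λ c → prefixCount V (Q ∷ʳ c)) ∎
    where open ≡-Reasoning

  prefixCount-drop : ∀ (V : Vector (Word σ) m) a P →
    prefixCount (drop 1 ∘ V) (a ∷ P) ≡ sum (λ c → prefixCount V (c ∷ a ∷ P))
  prefixCount-drop {σ} {m} V a P =
    trans (sum-cong-≗ (λ j → indicator-drop-≼ᵇ a P (V j))) (∑-comm {m} {σ} _)

  exactCount-absent : ∀ (V : Vector (Word σ) m) Q → ¬ ∃ (λ j → V j ≡ Q) → exactCount V Q ≡ 0
  exactCount-absent {m = zero}  V Q absent = refl
  exactCount-absent {m = suc m} V Q absent with V zero ≟ᴸ Q
  ... | yes V₀≡Q = contradiction (zero , V₀≡Q) absent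
  ... | no  _    = exactCount-absent (tail V) Q (λ (j , Vj≡Q) → absent (suc j , Vj≡Q))

  prefixCount-member : ∀ (V : Vector (Word σ) m) j → 0 < prefixCount V (V j)
  prefixCount-member {m = suc m} V j =
    subst (_≤ prefixCount V (V j)) (cong indicator (Equivalence.to T-≡ (≼ᵇ-refl (V j))))
      (term-≤-sum (λ i → indicator (V j ≼ᵇ V i)) j)

  length-drop-1 : ∀ (P w : Word σ) → length P < length w → length P ≤ length (drop 1 w)
  length-drop-1 P (b ∷ w) (s≤s P≤w) = P≤w

  length-≤-suc-drop-1 : ∀ (w : Word σ) → length w ≤ suc (length (drop 1 w))
  length-≤-suc-drop-1 []      = z≤n
  length-≤-suc-drop-1 (b ∷ w) = ≤-refl

  ∷-≼ᵇ : ∀ d a (P w : Word σ) → length P < length w →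
    (a ∷ P ≼ᵇ w) ≡ does (fromMaybe d (head w) ≟ a) ∧ (P ≼ᵇ drop 1 w)
  ∷-≼ᵇ d a P (b ∷ w) _ = refl

  length-∷ʳ : ∀ (w : Word σ) c → length (w ∷ʳ c) ≡ suc (length w)
  length-∷ʳ w c = trans (length-++ w) (+-comm (length w) 1)

  module _ (f : Word σ → ℕ) where

    Below : (Word σ → ℕ) → Set
    Below G = ∀ P → G P ≤ f P

    Saturated : (Word σ → ℕ) → Word σ → Set
    Saturated G w = ∀ c → f (w ∷ʳ c) ≤ G (w ∷ʳ c)

    Saturated-mono : ∀ {G H} → (∀ P → G P ≤ H P) → ∀ {w} → Saturated G w → Saturated H w
    Saturated-mono G≤H sat c = ≤-trans (sat c) (G≤H _)

    module _ (f-∷ʳ : ∀ Q → sum (λ c → f (Q ∷ʳ c)) ≤ f Q)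
             (V : Vector (Word σ) m) (below : Below (prefixCount V))
             (saturated : ∀ j → Saturated (prefixCount V) (V j)) where

      prefixCount-∷ʳ : ∀ Q → prefixCount V Q ≡ f Q → ∀ c → prefixCount V (Q ∷ʳ c) ≡ f (Q ∷ʳ c)
      prefixCount-∷ʳ Q eq with any? (λ j → V j ≟ᴸ Q)
      ... | yes (j , refl) = λ c → ≤-antisym (below _) (saturated j c)
      ... | no  absent     = sum-≤-tight (λ c → below (Q ∷ʳ c)) (begin
        sum (λ c → f (Q ∷ʳ c))      ≤⟨ f-∷ʳ Q ⟩
        f Q                         ≡⟨ sym eq ⟩
        prefixCount V Q             ≡⟨ prefixCount-split V Q ⟩
        exactCount V Q + extensions ≡⟨ cong (_+ extensions) (exactCount-absent V Q absent) ⟩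
        extensions                  ∎)
        where
        open ≤-Reasoning
        extensions = sum (λ c → prefixCount V (Q ∷ʳ c))

      prefixCount-++ : ∀ R Q → prefixCount V Q ≡ f Q → prefixCount V (Q ++ R) ≡ f (Q ++ R)
      prefixCount-++ []      Q eq rewrite ++-identityʳ Q = eq
      prefixCount-++ (c ∷ R) Q eq rewrite sym (++-assoc Q (c ∷ []) R) =
        prefixCount-++ R (Q ∷ʳ c) (prefixCount-∷ʳ Q eq c)

      prefixCount-exact : prefixCount V [] ≡ f [] → ∀ P → prefixCount V P ≡ f P
      prefixCount-exact eq P = prefixCount-++ P [] eq

  infixl 5 _⊕_ _⊕*_

  _⊕_ : (Word σ → ℕ) → Word σ → (Word σ → ℕ)
  (G ⊕ w) P = G P + indicator (P ≼ᵇ w)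

  _⊕*_ : (Word σ → ℕ) → Vector (Word σ) m → (Word σ → ℕ)
  (G ⊕* V) P = G P + prefixCount V P

  -- Here G counts the windows other than those being extended.
  module Saturation (f : Word σ → ℕ) (depth : ℕ) where

    extend : ℕ → (Word σ → ℕ) → Word σ → Word σ
    extend zero    G w = w
    extend (suc d) G w with any? (λ c → G (w ∷ʳ c) <? f (w ∷ʳ c))
    ... | yes (c , _) = extend d G (w ∷ʳ c)
    ... | no  _       = w

    extend-≼ᵇ : ∀ d G w → T (w ≼ᵇ extend d G w)
    extend-≼ᵇ zero    G w = ≼ᵇ-refl w
    extend-≼ᵇ (suc d) G w with any? (λ c → G (w ∷ʳ c) <? f (w ∷ʳ c))
    ... | yes (c , _) = ≼ᵇ-trans w (w ∷ʳ c) _ (≼ᵇ-∷ʳ w c) (extend-≼ᵇ d G (w ∷ʳ c))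
    ... | no  _       = ≼ᵇ-refl w

    extend-below : ∀ d G w → Below f (G ⊕ w) → Below f (G ⊕ extend d G w)
    extend-below zero    G w below = below
    extend-below (suc d) G w below with any? (λ c → G (w ∷ʳ c) <? f (w ∷ʳ c))
    ... | yes (c , G<f) = extend-below d G (w ∷ʳ c) below′
      where
      below′ : Below f (G ⊕ w ∷ʳ c)
      below′ P with P ≟ᴸ w ∷ʳ c
      ... | yes refl rewrite Equivalence.to T-≡ (≼ᵇ-refl (w ∷ʳ c)) = subst (_≤ f P) (+-comm 1 _) G<f
      ... | no  P≢wc rewrite ≼ᵇ-∷ʳ-≢ P w c P≢wc = below P
    ... | no  _ = below

    saturate : (Word σ → ℕ) → Vector (Word σ) m → Vector (Word σ) m
    saturate {suc m} G V zero    = extend depth (G ⊕* saturate (G ⊕ V zero) (tail V)) (V zero)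
    saturate {suc m} G V (suc j) = saturate (G ⊕ V zero) (tail V) j

    saturate-≼ᵇ : ∀ G (V : Vector (Word σ) m) j → T (V j ≼ᵇ saturate G V j)
    saturate-≼ᵇ {suc m} G V zero    = extend-≼ᵇ depth _ (V zero)
    saturate-≼ᵇ {suc m} G V (suc j) = saturate-≼ᵇ (G ⊕ V zero) (tail V) j

    Below-⊕*-tail : ∀ G (V : Vector (Word σ) (suc m)) →
      Below f (G ⊕* V) → Below f (G ⊕ V zero ⊕* tail V)
    Below-⊕*-tail G V below P = subst (_≤ f P) (sym (+-assoc (G P) _ _)) (below P)

    saturate-below : ∀ G (V : Vector (Word σ) m) → Below f (G ⊕* V) → Below f (G ⊕* saturate G V)
    saturate-below {zero}  G V below = below
    saturate-below {suc m} G V below P =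
      subst (_≤ f P) (sym (x∙yz≈xz∙y (G P) _ (prefixCount W P)))
        (extend-below depth (G ⊕* W) w below′ P)
      where
      w = V zero
      W = saturate (G ⊕ w) (tail V)
      below-W : Below f (G ⊕ w ⊕* W)
      below-W = saturate-below (G ⊕ w) (tail V) (Below-⊕*-tail G V below)
      below′ : Below f (G ⊕* W ⊕ w)
      below′ Q = subst (_≤ f Q) (sym (xy∙z≈xz∙y (G Q) (prefixCount W Q) _)) (below-W Q)

    module _ (bounded : ∀ P → 0 < f P → length P ≤ depth) where

      f-beyond-depth : ∀ P → depth < length P → f P ≡ 0
      f-beyond-depth P deep = n≤0⇒n≡0 (≮⇒≥ (λ 0<fP → <⇒≱ deep (bounded P 0<fP)))

      extend-saturated : ∀ d G w → depth ≤ d + length w → Saturated f G (extend d G w)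
      extend-saturated zero G w shallow c = subst (_≤ G (w ∷ʳ c)) (sym (f-beyond-depth (w ∷ʳ c) deep)) z≤n
        where
        deep : depth < length (w ∷ʳ c)
        deep = subst (depth <_) (sym (length-∷ʳ w c)) (s≤s shallow)
      extend-saturated (suc d) G w shallow with any? (λ c → G (w ∷ʳ c) <? f (w ∷ʳ c))
      ... | yes (c , _) = extend-saturated d G (w ∷ʳ c) (subst (depth ≤_) fuel shallow)
        where
        fuel : suc d + length w ≡ d + length (w ∷ʳ c)
        fuel = trans (sym (+-suc d _)) (cong (d +_) (sym (length-∷ʳ w c)))
      ... | no  none    = λ c → ≮⇒≥ (λ G<f → none (c , G<f))

      saturate-saturated : ∀ G (V : Vector (Word σ) m) → Below f (G ⊕* V) →
        ∀ j → Saturated f (G ⊕* saturate G V) (saturate G V j)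
      saturate-saturated {suc m} G V below zero =
        Saturated-mono f grow (extend-saturated depth (G ⊕* W) (V zero) (m≤m+n depth _))
        where
        W = saturate (G ⊕ V zero) (tail V)
        grow : ∀ Q → (G ⊕* W) Q ≤ (G ⊕* saturate G V) Q
        grow Q = +-monoʳ-≤ (G Q) (m≤n+m (prefixCount W Q) (indicator (Q ≼ᵇ saturate G V zero)))
      saturate-saturated {suc m} G V below (suc j) =
        Saturated-mono f grow (saturate-saturated (G ⊕ V zero) (tail V) (Below-⊕*-tail G V below) j)
        where
        grow : ∀ Q → (G ⊕ V zero ⊕* saturate (G ⊕ V zero) (tail V)) Q ≤ (G ⊕* saturate G V) Q
        grow Q = ≤-trans (≤-reflexive (+-assoc (G Q) _ _))
          (+-monoʳ-≤ (G Q) (+-monoˡ-≤ _ (indicator-mono (λ Q≼V₀ →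
            ≼ᵇ-trans Q (V zero) _ Q≼V₀ (saturate-≼ᵇ G V zero)))))

  count-sum : ∀ {n K} (S : Fin K → String σ n) (π : Fin K → Property n) P i →
    count S π P i ≡ sum (λ j → indicator (inOcc (π j) (S j) P i))
  count-sum {K = zero}  S π P i = refl
  count-sum {K = suc K} S π P i =
    cong (indicator (inOcc (π zero) (S zero) P i) +_) (count-sum (S ∘ suc) (π ∘ suc) P i)

  module Construction {n K : ℕ} (f : Word σ → ℕ → ℕ)
    (f-[]   : ∀ i → i < n → f [] i ≡ K)
    (f-∷ʳ   : ∀ P i → sum (λ c → f (P ∷ʳ c) i) ≤ f P i)
    (f-∷    : ∀ P i → sum (λ c → f (c ∷ P) i) ≤ f P (suc i))
    (f-fits : ∀ P i → i < n → 0 < f P i → i + length P ≤ n)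
    (letter : Fin n → Fin σ) where

    module Sat (i : ℕ) = Saturation (λ P → f P i) n

    saturateAt : ℕ → Vector (Word σ) K → Vector (Word σ) K
    saturateAt i = Sat.saturate i (λ _ → 0)

    saturateAt-exact : ∀ i → i < n → ∀ V → (∀ a P → prefixCount V (a ∷ P) ≤ f (a ∷ P) i) →
      ∀ P → prefixCount (saturateAt i V) P ≡ f P i
    saturateAt-exact i i<n V below-∷ =
      prefixCount-exact (λ P → f P i) (λ Q → f-∷ʳ Q i) (saturateAt i V)
        (Sat.saturate-below i _ V below) (Sat.saturate-saturated i bounded _ V below)
        (trans (prefixCount-[] (saturateAt i V)) (sym (f-[] i i<n)))
      where
      below : ∀ P → prefixCount V P ≤ f P i
      below []      = ≤-reflexive (trans (prefixCount-[] V) (sym (f-[] i i<n)))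
      below (a ∷ P) = below-∷ a P
      bounded : ∀ P → 0 < f P i → length P ≤ n
      bounded P 0<f = m+n≤o⇒n≤o i (f-fits P i i<n 0<f)

    windows : ℕ → Vector (Word σ) K
    windows zero    = saturateAt 0 (λ _ → [])
    windows (suc i) = saturateAt (suc i) (drop 1 ∘ windows i)

    windows-exact : ∀ i → i < n → ∀ P → prefixCount (windows i) P ≡ f P i
    windows-exact zero    0<n =
      saturateAt-exact 0 0<n _ (λ a P → ≤-trans (≤-reflexive (sum-replicate-zero K)) z≤n)
    windows-exact (suc i) i<n = saturateAt-exact (suc i) i<n _ λ a P → begin
      prefixCount (drop 1 ∘ windows i) (a ∷ P)        ≡⟨ prefixCount-drop (windows i) a P ⟩
      sum (λ c → prefixCount (windows i) (c ∷ a ∷ P)) ≡⟨ sum-cong-≗ (windows-exact i (<⇒≤ i<n) ∘ (_∷ a ∷ P)) ⟩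
      sum (λ c → f (c ∷ a ∷ P) i)                     ≤⟨ f-∷ (a ∷ P) i ⟩
      f (a ∷ P) (suc i)                               ∎
      where open ≤-Reasoning

    windows-drop-≼ᵇ : ∀ i j → T (drop 1 (windows i j) ≼ᵇ windows (suc i) j)
    windows-drop-≼ᵇ i = Sat.saturate-≼ᵇ (suc i) _ (drop 1 ∘ windows i)

    reach : Fin K → ℕ → ℕ
    reach j i = i + length (windows i j)

    reach-fits : ∀ j i → i < n → reach j i ≤ n
    reach-fits j i i<n = f-fits (windows i j) i i<n
      (subst (0 <_) (windows-exact i i<n (windows i j)) (prefixCount-member (windows i) j))

    reach-step : ∀ j i → reach j i ≤ reach j (suc i)
    reach-step j i = ≤-trans
      (+-monoʳ-≤ i (≤-trans (length-≤-suc-drop-1 (windows i j))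
                            (s≤s (≼ᵇ-length (drop 1 (windows i j)) _ (windows-drop-≼ᵇ i j)))))
      (≤-reflexive (+-suc i (length (windows (suc i) j))))

    reach-mono : ∀ j {i i′} → i ≤ i′ → reach j i ≤ reach j i′
    reach-mono j = go ∘ ≤⇒≤′
      where
      go : ∀ {i i′} → i ≤′ i′ → reach j i ≤ reach j i′
      go (≤′-reflexive refl) = ≤-refl
      go (≤′-step i≤i′)      = ≤-trans (go i≤i′) (reach-step j _)

    -- The default letter k is never inside an admitted occurrence: an occurrence
    -- covering position k extends, after dropping letters, into the window at k.
    string : Fin K → String σ n
    string j k = fromMaybe (letter k) (head (windows (toℕ k) j))

    property : Fin K → Property n
    property j = record
      { end      = reach j ∘ toℕ
      ; end-low  = λ k → m≤m+n (toℕ k) _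
      ; end-high = λ k → reach-fits j (toℕ k) (toℕ<n k)
      ; end-mono = λ k k′ → reach-mono j
      }

    matchesAt-window : ∀ j P i → i + length P ≤ n → i + length P ≤ reach j i →
      matchesAt (string j) P i ≡ (P ≼ᵇ windows i j)
    matchesAt-window j []      i _     _     = refl
    matchesAt-window j (a ∷ P) i fit-n fit-w with i <? n
    ... | no  i≮n = contradiction (<-≤-trans (m<m+n i z<s) fit-n) i≮n
    ... | yes i<n = begin
      ⌊ string j (fromℕ< i<n) ≟ a ⌋ ∧ matchesAt (string j) P (suc i)
        ≡⟨ cong₂ _∧_ (isYes≗does _) (matchesAt-window j P (suc i) fit-n′ fit-w′) ⟩
      does (string j (fromℕ< i<n) ≟ a) ∧ (P ≼ᵇ windows (suc i) j)
        ≡⟨ cong₂ (λ x y → does (x ≟ a) ∧ y) first-letter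
                 (sym (≼ᵇ-extend P _ _ (windows-drop-≼ᵇ i j) (length-drop-1 P w P<w))) ⟩
      does (fromMaybe (letter (fromℕ< i<n)) (head w) ≟ a) ∧ (P ≼ᵇ drop 1 w)
        ≡⟨ sym (∷-≼ᵇ _ a P w P<w) ⟩
      (a ∷ P ≼ᵇ w) ∎
      where
      open ≡-Reasoning
      w = windows i j
      P<w : length P < length w
      P<w = +-cancelˡ-≤ i _ _ fit-w
      fit-n′ : suc i + length P ≤ n
      fit-n′ = subst (_≤ n) (+-suc i _) fit-n
      fit-w′ : suc i + length P ≤ reach j (suc i)
      fit-w′ = ≤-trans (subst (_≤ reach j i) (+-suc i _) fit-w) (reach-step j i)
      first-letter : string j (fromℕ< i<n) ≡ fromMaybe (letter (fromℕ< i<n)) (head w)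
      first-letter = cong (λ t → fromMaybe (letter (fromℕ< i<n)) (head (windows t j))) (toℕ-fromℕ< i<n)

    inOcc-window : ∀ j P k → inOcc (property j) (string j) P k ≡ (P ≼ᵇ windows (toℕ k) j)
    inOcc-window j P k with toℕ k + length P ≤? reach j (toℕ k)
    ... | yes fit = trans (∧-identityʳ _)
          (matchesAt-window j P (toℕ k) (≤-trans fit (reach-fits j (toℕ k) (toℕ<n k))) fit)
    ... | no ¬fit = trans (∧-zeroʳ _) (sym (T-false (¬fit ∘ +-monoʳ-≤ (toℕ k) ∘ ≼ᵇ-length P _)))

    estimation : Σ (Fin K → String σ n) λ S → Σ (Fin K → Property n) λ π →
                 ∀ P k → count S π P k ≡ f P (toℕ k)
    estimation = string , property , λ P k → begin
      count string property P k
        ≡⟨ count-sum string property P k ⟩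
      sum (λ j → indicator (inOcc (property j) (string j) P k))
        ≡⟨ sum-cong-≗ (λ j → cong indicator (inOcc-window j P k)) ⟩
      prefixCount (windows (toℕ k)) P
        ≡⟨ windows-exact (toℕ k) (toℕ<n k) P ⟩
      f P (toℕ k) ∎
      where open ≡-Reasoning

open import Defs
open import Data.Nat as ℕ using (ℕ; zero; suc)
import Data.Nat.Properties as ℕ
open import Data.Fin using (Fin; zero; suc; toℕ; fromℕ<)
open import Data.List using (List; []; _∷_; length; _∷ʳ_)
open import Data.Integer as ℤ using (-[1+_]; ∣_∣)
open import Data.Product using (Σ; _,_; proj₁; proj₂)
open import Data.Sum using (inj₁; inj₂)
open import Function using (_∘_)
open import Relation.Nullary using (¬_; Dec; yes; no; contradiction)
open import Relation.Binary.PropositionalEquality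
open import Relation.Binary.Bundles using (Preorder)
open import Relation.Binary.Structures using (IsTotalOrder)
open import Algebra.Bundles using (CommutativeRing)
open import Algebra.Structures using (IsCommutativeRing)
open import Algebra.Properties.CommutativeMonoid.Sum ℕ.+-0-commutativeMonoid using (sum; sum-cong-≗)

module OrderedRingFacts (R : OrderedRingWithFloor) where

  open OrderedRingWithFloor R
  open IsCommutativeRing isCommutativeRing
    using (+-assoc; +-comm; +-identityˡ; +-identityʳ; -‿inverseˡ; -‿inverseʳ;
           distribʳ; zeroˡ; zeroʳ; *-identityʳ)
  open IsTotalOrder isTotalOrder public using (total; antisym)
    renaming (refl to ≤-refl; reflexive to ≤-reflexive; trans to ≤-trans)

  commutativeRing : CommutativeRing _ _
  commutativeRing = record { isCommutativeRing = isCommutativeRing }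

  open import Algebra.Properties.Ring (CommutativeRing.ring commutativeRing)
    using (-‿distribˡ-*; -1*x≈-x; -‿involutive)

  ≤-preorder : Preorder _ _ _
  ≤-preorder = record { isPreorder = IsTotalOrder.isPreorder isTotalOrder }

  fromℕ : ℕ → Carrier
  fromℕ = embedℕ _+_ 0# 1#

  <-≤-irrefl : ∀ {x y} → x < y → ¬ (y ≤ x)
  <-≤-irrefl (x≤y , x≢y) y≤x = x≢y (antisym x≤y y≤x)

  +-monoʳ-≤ : ∀ {x y} z → x ≤ y → z + x ≤ z + y
  +-monoʳ-≤ {x} {y} z x≤y = subst₂ _≤_ (+-comm x z) (+-comm y z) (+-mono-≤ z x≤y)

  +-mono-≤₂ : ∀ {x y u v} → x ≤ y → u ≤ v → x + u ≤ y + v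
  +-mono-≤₂ {y = y} {u} x≤y u≤v = ≤-trans (+-mono-≤ u x≤y) (+-monoʳ-≤ y u≤v)

  x≤y⇒0≤y-x : ∀ {x y} → x ≤ y → 0# ≤ y + - x
  x≤y⇒0≤y-x {x} {y} x≤y = subst (_≤ y + - x) (-‿inverseʳ x) (+-mono-≤ (- x) x≤y)

  0≤1 : 0# ≤ 1#
  0≤1 with total 0# 1#
  ... | inj₁ 0≤1 = 0≤1
  ... | inj₂ 1≤0 = subst (0# ≤_) (trans (-1*x≈-x (- 1#)) (-‿involutive 1#)) (*-nonneg 0≤-1 0≤-1)
    where
    0≤-1 : 0# ≤ - 1#
    0≤-1 = subst (0# ≤_) (+-identityˡ (- 1#)) (x≤y⇒0≤y-x 1≤0)

  *-monoʳ-≤ : ∀ {x y} u → 0# ≤ u → x ≤ y → x * u ≤ y * u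
  *-monoʳ-≤ {x} {y} u 0≤u x≤y =
    subst₂ _≤_ (+-identityˡ (x * u)) cancel (+-mono-≤ (x * u) 0≤yu-xu)
    where
    0≤yu-xu : 0# ≤ y * u + - (x * u)
    0≤yu-xu = subst (0# ≤_) (trans (distribʳ u y (- x)) (cong (y * u +_) (sym (-‿distribˡ-* x u))))
                (*-nonneg (x≤y⇒0≤y-x x≤y) 0≤u)
    cancel : y * u + - (x * u) + x * u ≡ y * u
    cancel = trans (+-assoc _ _ _) (trans (cong (y * u +_) (-‿inverseˡ (x * u))) (+-identityʳ _))

  fromℕ-+ : ∀ m k → fromℕ (m ℕ.+ k) ≡ fromℕ m + fromℕ k
  fromℕ-+ zero    k = sym (+-identityˡ (fromℕ k))
  fromℕ-+ (suc m) k = trans (cong (1# +_) (fromℕ-+ m k)) (sym (+-assoc 1# (fromℕ m) (fromℕ k)))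

  fromℕ-nonneg : ∀ m → 0# ≤ fromℕ m
  fromℕ-nonneg zero    = ≤-refl
  fromℕ-nonneg (suc m) = subst (_≤ 1# + fromℕ m) (+-identityˡ 0#) (+-mono-≤₂ 0≤1 (fromℕ-nonneg m))

  fromℕ-mono : ∀ {m k} → m ℕ.≤ k → fromℕ m ≤ fromℕ k
  fromℕ-mono {m} {k} m≤k = subst (λ t → fromℕ m ≤ fromℕ t) (ℕ.m+[n∸m]≡n m≤k)
    (subst₂ _≤_ (+-identityʳ (fromℕ m)) (sym (fromℕ-+ m (k ℕ.∸ m)))
      (+-monoʳ-≤ (fromℕ m) (fromℕ-nonneg (k ℕ.∸ m))))

  sumFin-mono : ∀ σ {g h : Fin σ → Carrier} → (∀ c → g c ≤ h c) → sumFin R σ g ≤ sumFin R σ h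
  sumFin-mono zero    g≤h = ≤-refl
  sumFin-mono (suc σ) g≤h = +-mono-≤₂ (g≤h zero) (sumFin-mono σ (λ c → g≤h (suc c)))

  sumFin-*ʳ : ∀ σ (g : Fin σ → Carrier) y → sumFin R σ (λ c → g c * y) ≡ sumFin R σ g * y
  sumFin-*ʳ zero    g y = sym (zeroˡ y)
  sumFin-*ʳ (suc σ) g y = trans (cong (g zero * y +_) (sumFin-*ʳ σ (g ∘ suc) y)) (sym (distribʳ y _ _))

  fromℕ-sum : ∀ σ (g : Fin σ → ℕ) → fromℕ (sum g) ≡ sumFin R σ (fromℕ ∘ g)
  fromℕ-sum zero    g = refl
  fromℕ-sum (suc σ) g = trans (fromℕ-+ (g zero) _) (cong (fromℕ (g zero) +_) (fromℕ-sum σ (g ∘ suc)))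

  sumFin-zero : ∀ σ → sumFin R σ (λ _ → 0#) ≡ 0#
  sumFin-zero zero    = refl
  sumFin-zero (suc σ) = trans (+-identityˡ _) (sumFin-zero σ)

  ⌊_⌋ℕ : Carrier → ℕ
  ⌊ x ⌋ℕ = ∣ floor x ∣

  floor+1-nonpos : ∀ k → fromℤ (-[1+ k ] ℤ.+ ℤ.+ 1) ≤ 0#
  floor+1-nonpos zero    = ≤-refl
  floor+1-nonpos (suc k) = subst₂ _≤_ (+-identityˡ _) (-‿inverseʳ (fromℕ (suc k)))
    (+-mono-≤ (- fromℕ (suc k)) (fromℕ-nonneg (suc k)))

  floor-nonneg : ∀ {x} → 0# ≤ x → floor x ≡ ℤ.+ ⌊ x ⌋ℕ
  floor-nonneg {x} 0≤x with floor x | <-floor+1 x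
  ... | ℤ.+ k    | _        = refl
  ... | -[1+ k ] | x<⌊x⌋+1 = contradiction (≤-trans (floor+1-nonpos k) 0≤x) (<-≤-irrefl x<⌊x⌋+1)

  fromℕ-⌊⌋ℕ-≤ : ∀ {x} → 0# ≤ x → fromℕ ⌊ x ⌋ℕ ≤ x
  fromℕ-⌊⌋ℕ-≤ {x} 0≤x = subst (λ t → fromℤ t ≤ x) (floor-nonneg 0≤x) (floor-≤ x)

  ≤-⌊⌋ℕ : ∀ {m x} → fromℕ m ≤ x → m ℕ.≤ ⌊ x ⌋ℕ
  ≤-⌊⌋ℕ {m} {x} m≤x with m ℕ.≤? ⌊ x ⌋ℕ
  ... | yes m≤⌊x⌋ = m≤⌊x⌋
  ... | no  m≰⌊x⌋ = contradiction (≤-trans (fromℕ-mono ⌊x⌋+1≤m) m≤x) (<-≤-irrefl x<⌊x⌋+1)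
    where
    ⌊x⌋+1≤m : ⌊ x ⌋ℕ ℕ.+ 1 ℕ.≤ m
    ⌊x⌋+1≤m = subst (ℕ._≤ m) (ℕ.+-comm 1 _) (ℕ.≰⇒> m≰⌊x⌋)
    x<⌊x⌋+1 : x < fromℕ (⌊ x ⌋ℕ ℕ.+ 1)
    x<⌊x⌋+1 = subst (λ t → x < fromℤ (t ℤ.+ ℤ.+ 1))
                (floor-nonneg (≤-trans (fromℕ-nonneg m) m≤x)) (<-floor+1 x)

  sum-⌊⌋ℕ-≤ : ∀ σ (xs : Fin σ → Carrier) y → (∀ c → 0# ≤ xs c) → sumFin R σ xs ≤ y →
    sum (λ c → ⌊ xs c ⌋ℕ) ℕ.≤ ⌊ y ⌋ℕ
  sum-⌊⌋ℕ-≤ σ xs y 0≤xs Σxs≤y = ≤-⌊⌋ℕ (begin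
    fromℕ (sum (λ c → ⌊ xs c ⌋ℕ))       ≡⟨ fromℕ-sum σ _ ⟩
    sumFin R σ (λ c → fromℕ ⌊ xs c ⌋ℕ) ∼⟨ sumFin-mono σ (fromℕ-⌊⌋ℕ-≤ ∘ 0≤xs) ⟩
    sumFin R σ xs                      ∼⟨ Σxs≤y ⟩
    y                                  ∎)
    where open import Relation.Binary.Reasoning.Preorder ≤-preorder

  ⌊0⌋ℕ : 0# ≢ 1# → ⌊ 0# ⌋ℕ ≡ 0
  ⌊0⌋ℕ 0≢1 = ℕ.n≤0⇒n≡0 (ℕ.≮⇒≥ λ 0<⌊0⌋ → 0≢1 (antisym 0≤1 (1≤0 0<⌊0⌋)))
    where
    1≤0 : 0 ℕ.< ⌊ 0# ⌋ℕ → 1# ≤ 0#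
    1≤0 0<⌊0⌋ = subst (_≤ 0#) (+-identityʳ 1#)
      (≤-trans (fromℕ-mono 0<⌊0⌋) (fromℕ-⌊⌋ℕ-≤ ≤-refl))

module WeightedSequenceFacts (R : OrderedRingWithFloor) {σ n : ℕ} (X : WeightedSequence R σ n) where

  open OrderedRingWithFloor R
  open OrderedRingFacts R
  open WeightedSequence X
  open IsCommutativeRing isCommutativeRing using (*-assoc; *-identityˡ; *-identityʳ; zeroˡ; zeroʳ)

  pAt-inside : ∀ {k} (k<n : k ℕ.< n) c → pAt R X k c ≡ p (fromℕ< k<n) c
  pAt-inside {k} k<n c with k ℕ.<? n
  ... | yes k<n′ = cong (λ t → p (fromℕ< t) c) (ℕ.<-irrelevant k<n′ k<n)
  ... | no  k≮n  = contradiction k<n k≮n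

  pAt-outside : ∀ {k} → ¬ k ℕ.< n → ∀ c → pAt R X k c ≡ 0#
  pAt-outside {k} k≮n c with k ℕ.<? n
  ... | yes k<n = contradiction k<n k≮n
  ... | no  _   = refl

  pAt-nonneg : ∀ k c → 0# ≤ pAt R X k c
  pAt-nonneg k c with k ℕ.<? n
  ... | yes k<n = p-nonneg (fromℕ< k<n) c
  ... | no  _   = ≤-refl

  sum-pAt-≤1 : ∀ k → sumFin R σ (pAt R X k) ≤ 1#
  sum-pAt-≤1 k = bound (k ℕ.<? n)
    where
    bound : Dec (k ℕ.< n) → sumFin R σ (pAt R X k) ≤ 1#
    bound (yes k<n) = ≤-trans (sumFin-mono σ (≤-reflexive ∘ pAt-inside k<n))
                              (≤-reflexive (p-sum (fromℕ< k<n)))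
    bound (no  k≮n) = ≤-trans (sumFin-mono σ (≤-reflexive ∘ pAt-outside k≮n))
                              (≤-trans (≤-reflexive (sumFin-zero σ)) 0≤1)

  matchProb-nonneg : ∀ P i → 0# ≤ matchProb R X P i
  matchProb-nonneg []      i = 0≤1
  matchProb-nonneg (c ∷ P) i = *-nonneg (pAt-nonneg i c) (matchProb-nonneg P (suc i))

  matchProb-∷ʳ : ∀ P i c → matchProb R X (P ∷ʳ c) i ≡ matchProb R X P i * pAt R X (i ℕ.+ length P) c
  matchProb-∷ʳ []      i c rewrite ℕ.+-identityʳ i = trans (*-identityʳ _) (sym (*-identityˡ _))
  matchProb-∷ʳ (a ∷ P) i c rewrite matchProb-∷ʳ P (suc i) c | ℕ.+-suc i (length P) = sym (*-assoc _ _ _)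

  matchProb-beyond : ∀ a P i → n ℕ.< i ℕ.+ length (a ∷ P) → matchProb R X (a ∷ P) i ≡ 0#
  matchProb-beyond a P i beyond with i ℕ.<? n
  matchProb-beyond a P       i beyond | no  _   = zeroˡ _
  matchProb-beyond a []      i beyond | yes i<n =
    contradiction (ℕ.m<1+n⇒m≤n (subst (n ℕ.<_) (ℕ.+-comm i 1) beyond)) (ℕ.<⇒≱ i<n)
  matchProb-beyond a (b ∷ P) i beyond | yes _   =
    trans (cong (_ *_) (matchProb-beyond b P (suc i) (subst (n ℕ.<_) (ℕ.+-suc i _) beyond))) (zeroʳ _)

module Expected (R : OrderedRingWithFloor) {σ n : ℕ} (X : WeightedSequence R σ n)
  (z : OrderedRingWithFloor.Carrier R) (0<z : OrderedRingWithFloor._<_ R (OrderedRingWithFloor.0# R) z) where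

  open OrderedRingWithFloor R
  open OrderedRingFacts R
  open WeightedSequenceFacts R X
  open IsCommutativeRing isCommutativeRing using (*-assoc; *-identityˡ; *-identityʳ; zeroˡ; zeroʳ)
  open import Algebra.Properties.CommutativeSemigroup (CommutativeRing.*-commutativeSemigroup commutativeRing)
    using (xy∙z≈y∙xz)

  0≢1 : 0# ≢ 1#
  0≢1 0≡1 = proj₂ 0<z (trans (sym (zeroʳ z)) (trans (cong (z *_) 0≡1) (*-identityʳ z)))

  scaled : List (Fin σ) → ℕ → Carrier
  scaled P i = matchProb R X P i * z

  scaled-nonneg : ∀ P i → 0# ≤ scaled P i
  scaled-nonneg P i = *-nonneg (matchProb-nonneg P i) (proj₁ 0<z)

  expected : List (Fin σ) → ℕ → ℕ
  expected P i = ⌊ scaled P i ⌋ℕ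

  sum-⌊pAt*⌋ℕ-≤ : ∀ k y → 0# ≤ y → sum (λ c → ⌊ pAt R X k c * y ⌋ℕ) ℕ.≤ ⌊ y ⌋ℕ
  sum-⌊pAt*⌋ℕ-≤ k y 0≤y = sum-⌊⌋ℕ-≤ σ _ y (λ c → *-nonneg (pAt-nonneg k c) 0≤y)
    (≤-trans (≤-reflexive (sumFin-*ʳ σ (pAt R X k) y))
      (≤-trans (*-monoʳ-≤ y 0≤y (sum-pAt-≤1 k)) (≤-reflexive (*-identityˡ y))))

  expected-[] : ∀ i → i ℕ.< n → expected [] i ≡ ⌊ z ⌋ℕ
  expected-[] i _ = cong ⌊_⌋ℕ (*-identityˡ z)

  expected-∷ʳ : ∀ P i → sum (λ c → expected (P ∷ʳ c) i) ℕ.≤ expected P i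
  expected-∷ʳ P i = ℕ.≤-trans (ℕ.≤-reflexive (sum-cong-≗ {σ} λ c → cong ⌊_⌋ℕ (begin
      matchProb R X (P ∷ʳ c) i * z                           ≡⟨ cong (_* z) (matchProb-∷ʳ P i c) ⟩
      matchProb R X P i * pAt R X (i ℕ.+ length P) c * z     ≡⟨ xy∙z≈y∙xz _ _ z ⟩
      pAt R X (i ℕ.+ length P) c * scaled P i                ∎)))
    (sum-⌊pAt*⌋ℕ-≤ (i ℕ.+ length P) (scaled P i) (scaled-nonneg P i))
    where open ≡-Reasoning

  expected-∷ : ∀ P i → sum (λ c → expected (c ∷ P) i) ℕ.≤ expected P (suc i)
  expected-∷ P i = ℕ.≤-trans (ℕ.≤-reflexive (sum-cong-≗ {σ} λ c → cong ⌊_⌋ℕ (*-assoc _ _ z)))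
    (sum-⌊pAt*⌋ℕ-≤ i (scaled P (suc i)) (scaled-nonneg P (suc i)))

  expected-fits : ∀ P i → i ℕ.< n → 0 ℕ.< expected P i → i ℕ.+ length P ℕ.≤ n
  expected-fits []      i i<n _ = ℕ.≤-trans (ℕ.≤-reflexive (ℕ.+-identityʳ i)) (ℕ.<⇒≤ i<n)
  expected-fits (a ∷ P) i _ 0<e with i ℕ.+ length (a ∷ P) ℕ.≤? n
  ... | yes fits = fits
  ... | no  ¬fits = contradiction vanishes (ℕ.>⇒≢ 0<e)
    where
    vanishes : expected (a ∷ P) i ≡ 0
    vanishes = begin
      ⌊ matchProb R X (a ∷ P) i * z ⌋ℕ ≡⟨ cong (⌊_⌋ℕ ∘ (_* z)) (matchProb-beyond a P i (ℕ.≰⇒> ¬fits)) ⟩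
      ⌊ 0# * z ⌋ℕ                      ≡⟨ cong ⌊_⌋ℕ (zeroˡ z) ⟩
      ⌊ 0# ⌋ℕ                          ≡⟨ ⌊0⌋ℕ 0≢1 ⟩
      0                                ∎
      where open ≡-Reasoning

  letter : Fin n → Fin σ
  letter k = nonempty (p k) (p-sum k)
    where
    open WeightedSequence X using (p; p-sum)
    nonempty : ∀ {τ} (g : Fin τ → Carrier) → sumFin R τ g ≡ 1# → Fin τ
    nonempty {zero}  g Σg≡1 = contradiction Σg≡1 0≢1
    nonempty {suc τ} g _    = zero

  open WindowFamilies.Construction expected expected-[] expected-∷ʳ expected-∷ expected-fits letter public
    using (estimation)

open import Data.Integer using (+_)

theorem1 : (R : OrderedRingWithFloor) (σ n : ℕ) (X : WeightedSequence R σ n)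
           (z : OrderedRingWithFloor.Carrier R) →
           OrderedRingWithFloor._<_ R (OrderedRingWithFloor.0# R) z →
           Σ (Fin ∣ OrderedRingWithFloor.floor R z ∣ → String σ n) λ S →
           Σ (Fin ∣ OrderedRingWithFloor.floor R z ∣ → Property n) λ π →
           (P : List (Fin σ)) (i : Fin n) →
           + count S π P i
             ≡ OrderedRingWithFloor.floor R
                 (OrderedRingWithFloor._*_ R (matchProb R X P (toℕ i)) z)
theorem1 R σ n X z 0<z =
  let (S , π , count≡expected) = estimation in
  S , π , λ P i → trans (cong +_ (count≡expected P i)) (sym (floor-nonneg (scaled-nonneg P (toℕ i))))
  where
  open Expected R X z 0<z
  open OrderedRingFacts R using (floor-nonneg)
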